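{- Let $A$ and $B$ be automata. (1) If $(f,n)$ is a normed forward simulation from $A$ to $B$, then $f$ is a branching forward simulation from $A$ to $B$. (2) If $f$ is a branching forward simulation from $A$ to $B$, define $n:\mathit{steps}(A)\times\mathit{states}(B)\to\mathbb{N}$ by $n(s\xrightarrow{a}t,u)=0$ if $u\notin f[s]$, and otherwise $n(s\xrightarrow{a}t,u)$ is the length of the shortest execution fragment of $B$ that starts in $u$ and corresponds via $f$ to the execution fragment $s\,a\,t$ of $A$. Then $(f,n)$ is a normed forward simulation from $A$ to $B$.
   Context: An automaton $A$ consists of a set $\mathit{states}(A)$, a nonempty set $\mathit{start}(A)\subseteq\mathit{states}(A)$, a set $\mathit{acts}(A)$ of actions containing a distinguished internal action $\tau$, and $\mathit{steps}(A)\subseteq \mathit{states}(A)\times\mathit{acts}(A)\times\mathit{states}(A)$; write $s\xrightarrow{a}_A t$. An execution fragment is a finite or infinite alternating sequence $s_0a_1s_1a_2\cdots$ starting with a state (ending with a state if finite) with $s_{i-1}\xrightarrow{a_i}_A s_i$; its length is its number of steps. Write $f[s]=\{u\mid(s,u)\in f\}$. Correspondence: for $R\subseteq\mathit{states}(A)\times\mathit{states}(B)$ and execution fragments $\alpha=s_0a_1s_1\cdots$ of $A$, $\alpha'=u_0b_1u_1\cdots$ of $B$ with state index sets $\mathrm{Ind}(\alpha),\mathrm{Ind}(\alpha')$, $\alpha$ and $\alpha'$ correspond via $R$ if there is $I\subseteq\mathrm{Ind}(\alpha)\times\mathrm{Ind}(\alpha')$ with: (1) $(i,j)\in I\Rightarrow(s_i,u_j)\in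 R$; (2) $(i,j),(i',j')\in I$, $i<i'\Rightarrow j\le j'$; (3) $I$ and $I^{ -1}$ total; (4) $(i,j),(i+1,j+1)\in I\Rightarrow a_{i+1}=b_{j+1}$; $(i,j),(i+1,j)\in I\Rightarrow a_{i+1}=\tau$; $(i,j),(i,j+1)\in I\Rightarrow b_{j+1}=\tau$. A normed forward simulation from $A$ to $B$ is a pair $(f,n)$, $f\subseteq\mathit{states}(A)\times\mathit{states}(B)$, $n:\mathit{steps}(A)\times\mathit{states}(B)\to S$ for a well-founded ordered set $(S,<)$, such that (1) $s\in\mathit{start}(A)\Rightarrow f[s]\cap\mathit{start}(B)\ne\emptyset$; (2) if $s\xrightarrow{a}_A t$ and $u\in f[s]$ then (a) $u\in f[t]$ and $a=\tau$, or (b) $\exists v\in f[t]: u\xrightarrow{a}_B v$, or (c) $\exists v\in f[s]: u\xrightarrow{\tau}_B v$ and $n(s\xrightarrow{a}t,v)<n(s\xrightarrow{a}t,u)$. A branching forward simulation from $A$ to $B$ is a relation $f\subseteq\mathit{states}(A)\times\mathit{states}(B)$ such that (1) $s\in\mathit{start}(A)\Rightarrow f[s]\cap\mathit{start}(B)\ne\emptyset$; (2) if $s\xrightarrow{a}_A t$ and $u\in f[s]$ then $B$ has an execution fragment starting in $u$ that corresponds via $f$ to the execution fragment $s\,a\,t$. -}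

module Defs where

open import Data.Nat using (ℕ; zero; suc; _≤_; _<_)
open import Data.Unit using (⊤)
open import Data.Product using (Σ; _×_; ∃; _,_)
open import Data.Sum using (_⊎_)
open import Relation.Binary.PropositionalEquality using (_≡_)
open import Relation.Nullary using (¬_)
open import Induction.WellFounded using (WellFounded)

-- Actions of all automata live in a common universe `Act` with a
-- distinguished internal action τ (so actions of A and B can be compared).
module Automata (Act : Set) (τ : Act) where

  record Automaton : Set₁ where
    field
      State    : Set
      Start    : State → Set
      start≠∅  : ∃ Start
      Acts     : Act → Set
      τ∈Acts   : Acts τ
      Step     : State → Act → State → Set
      stepActs : ∀ {s a t} → Step s a t → Acts a
  open Automaton public

  -- length of an execution fragment: finite n (number of steps) or infinite
  data Len : Set where
    fin : ℕ → Len
    ω   : Len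

  _∈Ind_ : ℕ → Len → Set
  i ∈Ind fin n = i ≤ n
  i ∈Ind ω     = ⊤

  -- Execution fragment s₀ a₁ s₁ a₂ ⋯ : state i is `st i`, action a_{i+1}
  -- (between st i and st (suc i)) is `ac i`; values beyond the length are junk.
  record Frag (A : Automaton) : Set where
    field
      len  : Len
      st   : ℕ → State A
      ac   : ℕ → Act
      step : ∀ i → suc i ∈Ind len → Step A (st i) (ac i) (st (suc i))
  open Frag public

  single : (A : Automaton) {s : State A} {a : Act} {t : State A} →
           Step A s a t → Frag A
  single A {s} {a} {t} p = record
    { len = fin 1 ; st = λ { zero → s ; (suc _) → t } ; ac = λ _ → a
    ; step = λ { zero _ → p ; (suc i) (Data.Nat.s≤s ()) } }

  Corr : {A B : Automaton} → (State A → State B → Set) → Frag A → Frag B → Set₁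
  Corr R α α' = Σ (ℕ → ℕ → Set) λ I →
      (∀ {i j} → I i j → (i ∈Ind len α) × (j ∈Ind len α'))
    × (∀ {i j} → I i j → R (st α i) (st α' j))
    × (∀ {i j i' j'} → I i j → I i' j' → i < i' → j ≤ j')
    × (∀ i → i ∈Ind len α → ∃ λ j → I i j)
    × (∀ j → j ∈Ind len α' → ∃ λ i → I i j)
    × (∀ {i j} → I i j → I (suc i) (suc j) → ac α i ≡ ac α' j)
    × (∀ {i j} → I i j → I (suc i) j → ac α i ≡ τ)
    × (∀ {i j} → I i j → I i (suc j) → ac α' j ≡ τ)

  Norm : Automaton → Automaton → Set → Set
  Norm A B S = ∀ {s a t} → Step A s a t → State B → S

  IsNormedForwardSim : (A B : Automaton) (f : State A → State B → Set)
                       (S : Set) (_<ₛ_ : S → S → Set) (n : Norm A B S) → Set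
  IsNormedForwardSim A B f S _<ₛ_ n =
      WellFounded _<ₛ_
    × (∀ s → Start A s → ∃ λ u → f s u × Start B u)
    × (∀ {s a t} (p : Step A s a t) u → f s u →
          (f t u × a ≡ τ)
        ⊎ (∃ λ v → f t v × Step B u a v)
        ⊎ (∃ λ v → f s v × Step B u τ v × (n p v <ₛ n p u)))

  IsBranchingForwardSim : (A B : Automaton) (f : State A → State B → Set) → Set₁
  IsBranchingForwardSim A B f =
      (∀ s → Start A s → ∃ λ u → f s u × Start B u)
    × (∀ {s a t} (p : Step A s a t) u → f s u →
          Σ (Frag B) λ β → (st β 0 ≡ u) × Corr f (single A p) β)

  IsShortestLen : (A B : Automaton) (f : State A → State B → Set)
                  {s : State A} {a : Act} {t : State A} →
                  Step A s a t → State B → ℕ → Set₁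
  IsShortestLen A B f p u k =
      (Σ (Frag B) λ β → len β ≡ fin k × st β 0 ≡ u × Corr f (single A p) β)
    × (∀ (β : Frag B) k' → len β ≡ fin k' → st β 0 ≡ u →
          Corr f (single A p) β → k ≤ k')

  IsBranchingNorm : (A B : Automaton) (f : State A → State B → Set)
                    (n : Norm A B ℕ) → Set₁
  IsBranchingNorm A B f n = ∀ {s a t} (p : Step A s a t) u →
      (¬ f s u → n p u ≡ 0) × (f s u → IsShortestLen A B f p u (n p u))

-- (1) By well-founded induction on the norm: a step of A is matched either by
-- staying put, by one step of B, or by a τ-step of B that lowers the norm, after
-- which the induction hypothesis gives a fragment that is extended by that τ-step.
-- (2) A shortest corresponding fragment either stutters, starts with the matching
-- step, or starts with a τ-step to a state still related to s; its tail then
-- corresponds to  s a t  as well and is one step shorter, so the norm drops.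
module Submission where

open import Defs
open import Data.Nat using (ℕ; zero; suc; _≤_; _<_; z≤n; s≤s; s≤s⁻¹)
open import Data.Nat.Properties using (<⇒≤)
open import Data.Nat.Induction using (<-wellFounded)
open import Data.Product using (Σ; ∃; _×_; _,_; proj₁; proj₂)
open import Data.Sum using (_⊎_; inj₁; inj₂)
open import Data.Unit using (tt)
open import Relation.Binary.PropositionalEquality using (_≡_; refl; sym; trans; subst)
open import Induction.WellFounded using (Acc; acc)

module Simulations (Act : Set) (τ : Act) where
  open Automata Act τ

  sucLen : Len → Len
  sucLen (fin n) = fin (suc n)
  sucLen ω       = ω

  fin-injective : ∀ {m n} → fin m ≡ fin n → m ≡ n
  fin-injective refl = refl

  0∈Ind : ∀ l → 0 ∈Ind l
  0∈Ind (fin n) = z≤n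
  0∈Ind ω       = tt

  suc∈Ind⁺ : ∀ j l → j ∈Ind l → suc j ∈Ind sucLen l
  suc∈Ind⁺ j (fin n) j≤n = s≤s j≤n
  suc∈Ind⁺ j ω       _   = tt

  suc∈Ind⁻ : ∀ j l → suc j ∈Ind sucLen l → j ∈Ind l
  suc∈Ind⁻ j (fin n) j<n = s≤s⁻¹ j<n
  suc∈Ind⁻ j ω       _   = tt

  module Fragments {A B : Automaton} {R : State A → State B → Set} where

    Corr-links-origins : (α : Frag A) (β : Frag B) (c : Corr R α β) → proj₁ c 0 0
    Corr-links-origins α β (I , _ , _ , mono , total , total⁻¹ , _)
      with total⁻¹ 0 (0∈Ind (len β))
    ... | zero  , I00  = I00
    ... | suc _ , Ii0 with total 0 (0∈Ind (len α))
    ...   | j , I0j with mono I0j Ii0 (s≤s z≤n)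
    ...     | z≤n = I0j


    prepend-τ : (u : State B) (β : Frag B) → Step B u τ (st β 0) → Frag B
    prepend-τ u β u→β₀ = record
      { len  = sucLen (len β)
      ; st   = λ { zero → u ; (suc j) → st β j }
      ; ac   = λ { zero → τ ; (suc j) → ac β j }
      ; step = λ { zero _ → u→β₀ ; (suc j) j+2∈ → step β j (suc∈Ind⁻ (suc j) (len β) j+2∈) } }

    -- The new state 0 of B is matched with state 0 of α only; everything else shifts by one.
    Corr-prepend-τ : (α : Frag A) (u : State B) (β : Frag B) (u→β₀ : Step B u τ (st β 0)) →
                     R (st α 0) u → Corr R α β → Corr R α (prepend-τ u β u→β₀)
    Corr-prepend-τ α u β u→β₀ Rα₀u c@(I , I⊆Ind , I⊆R , mono , total , total⁻¹ , I-step , I-stutˡ , I-stutʳ) =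
        I′ , (λ {i} {j} → I′⊆Ind {i} {j}) , (λ {i} {j} → I′⊆R {i} {j})
      , (λ {i} {j} {i′} {j′} → I′-mono {i} {j} {i′} {j′}) , I′-total , I′-total⁻¹
      , (λ {i} {j} → I′-step {i} {j}) , (λ {i} {j} → I′-stutˡ {i} {j}) , (λ {i} {j} → I′-stutʳ {i} {j})
      where
      β′ = prepend-τ u β u→β₀
      I′ : ℕ → ℕ → Set
      I′ i zero    = i ≡ 0
      I′ i (suc j) = I i j
      I′⊆Ind : ∀ {i j} → I′ i j → (i ∈Ind len α) × (j ∈Ind len β′)
      I′⊆Ind {j = zero}  refl = 0∈Ind (len α) , 0∈Ind (len β′)
      I′⊆Ind {j = suc j} Iij  = proj₁ (I⊆Ind Iij) , suc∈Ind⁺ j (len β) (proj₂ (I⊆Ind Iij))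
      I′⊆R : ∀ {i j} → I′ i j → R (st α i) (st β′ j)
      I′⊆R {j = zero}  refl = Rα₀u
      I′⊆R {j = suc j} Iij  = I⊆R Iij
      I′-mono : ∀ {i j i′ j′} → I′ i j → I′ i′ j′ → i < i′ → j ≤ j′
      I′-mono {j = zero}                _   _    _   = z≤n
      I′-mono {j = suc j} {j′ = zero}   _   refl ()
      I′-mono {j = suc j} {j′ = suc j′} Iij Ii′j′ i<i′ = s≤s (mono Iij Ii′j′ i<i′)
      I′-total : ∀ i → i ∈Ind len α → ∃ λ j → I′ i j
      I′-total i i∈ = let j , Iij = total i i∈ in suc j , Iij
      I′-total⁻¹ : ∀ j → j ∈Ind len β′ → ∃ λ i → I′ i j
      I′-total⁻¹ zero    _    = 0 , refl
      I′-total⁻¹ (suc j) j+1∈ = total⁻¹ j (suc∈Ind⁻ j (len β) j+1∈)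
      I′-step : ∀ {i j} → I′ i j → I′ (suc i) (suc j) → ac α i ≡ ac β′ j
      I′-step {j = zero}  refl I10  = I-stutˡ (Corr-links-origins α β c) I10
      I′-step {j = suc j} Iij  Ii+1 = I-step Iij Ii+1
      I′-stutˡ : ∀ {i j} → I′ i j → I′ (suc i) j → ac α i ≡ τ
      I′-stutˡ {j = zero}  refl ()
      I′-stutˡ {j = suc j} Iij  Ii+1j = I-stutˡ Iij Ii+1j
      I′-stutʳ : ∀ {i j} → I′ i j → I′ i (suc j) → ac β′ j ≡ τ
      I′-stutʳ {j = zero}  _   _     = refl
      I′-stutʳ {j = suc j} Iij Iij+1 = I-stutʳ Iij Iij+1

    idle : State B → Frag B
    idle u = record { len = fin 0 ; st = λ _ → u ; ac = λ _ → τ ; step = λ _ () }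

    Corr-idle : ∀ {s t} (p : Step A s τ t) u → R s u → R t u → Corr R (single A p) (idle u)
    Corr-idle p u Rsu Rtu =
        I , I⊆Ind , I⊆R , (λ { (_ , refl) _ _ → z≤n })
      , (λ i i≤1 → 0 , i≤1 , refl) , (λ { zero _ → 0 , z≤n , refl })
      , (λ _ _ → refl) , (λ _ _ → refl) , (λ _ _ → refl)
      where
      I : ℕ → ℕ → Set
      I i j = (i ≤ 1) × (j ≡ 0)
      I⊆Ind : ∀ {i j} → I i j → (i ≤ 1) × (j ≤ 0)
      I⊆Ind (i≤1 , refl) = i≤1 , z≤n
      I⊆R : ∀ {i j} → I i j → R (st (single A p) i) u
      I⊆R (z≤n     , refl) = Rsu
      I⊆R (s≤s z≤n , refl) = Rtu

    Corr-single : ∀ {s a t u v} (p : Step A s a t) (q : Step B u a v) →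
                  R s u → R t v → Corr R (single A p) (single B q)
    Corr-single p q Rsu Rtv =
        I , (λ { (refl , i≤1) → i≤1 , i≤1 }) , I⊆R , (λ { (refl , _) (refl , _) → <⇒≤ })
      , (λ i i≤1 → i , refl , i≤1) , (λ j j≤1 → j , refl , j≤1)
      , (λ _ _ → refl) , (λ { (refl , _) (() , _) }) , (λ { (refl , _) (() , _) })
      where
      I : ℕ → ℕ → Set
      I i j = (i ≡ j) × (i ≤ 1)
      I⊆R : ∀ {i j} → I i j → R (st (single A p) i) (st (single B q) j)
      I⊆R (refl , z≤n)     = Rsu
      I⊆R (refl , s≤s z≤n) = Rtv

    tail : (β : Frag B) {k : ℕ} → len β ≡ fin (suc k) → Frag B
    tail β {k} e = record
      { len  = fin k
      ; st   = λ j → st β (suc j)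
      ; ac   = λ j → ac β (suc j)
      ; step = λ j j<k → step β (suc j) (subst (suc (suc j) ∈Ind_) (sym e) (s≤s j<k)) }

    data FirstMove {s a t} (p : Step A s a t) (β : Frag B) : Set₁ where
      stutter : R t (st β 0) → a ≡ τ → FirstMove p β
      match   : R t (st β 1) → Step B (st β 0) a (st β 1) → FirstMove p β
      τ-lead  : ∀ {k} (e : len β ≡ fin (suc k)) → R s (st β 1) → Step B (st β 0) τ (st β 1) →
                Corr R (single A p) (tail β e) → FirstMove p β

    firstMove : ∀ {s a t} (p : Step A s a t) (β : Frag B) {k} → len β ≡ fin k →
                Corr R (single A p) β → FirstMove p β
    firstMove p β {zero} e c@(I , I⊆Ind , I⊆R , _ , total , _ , _ , I-stutˡ , _)
      with total 1 (s≤s z≤n)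
    ... | j , I1j with subst (j ∈Ind_) e (proj₂ (I⊆Ind I1j))
    ...   | z≤n = stutter (I⊆R I1j) (I-stutˡ (Corr-links-origins (single A p) β c) I1j)
    firstMove p β {suc k} e c@(I , I⊆Ind , I⊆R , mono , total , total⁻¹ , I-step , I-stutˡ , I-stutʳ)
      with total⁻¹ 1 (subst (1 ∈Ind_) (sym e) (s≤s z≤n))
    ... | i , Ii1 with proj₁ (I⊆Ind Ii1)
    ...   | s≤s z≤n = match (I⊆R Ii1) (subst (λ x → Step B (st β 0) x (st β 1))
                                             (sym (I-step (Corr-links-origins (single A p) β c) Ii1)) β₀→β₁)
      where β₀→β₁ = step β 0 (subst (1 ∈Ind_) (sym e) (s≤s z≤n))
    ...   | z≤n = τ-lead e (I⊆R Ii1) (subst (λ x → Step B (st β 0) x (st β 1))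
                                            (I-stutʳ (Corr-links-origins (single A p) β c) Ii1) β₀→β₁) c′
      where
      β₀→β₁ = step β 0 (subst (1 ∈Ind_) (sym e) (s≤s z≤n))
      I′ : ℕ → ℕ → Set
      I′ i j = I i (suc j)
      I′-total : ∀ i → i ≤ 1 → ∃ λ j → I′ i j
      I′-total zero _ = 0 , Ii1
      I′-total (suc i) i+1≤1 with total (suc i) i+1≤1
      ... | suc j , I1j = j , I1j
      ... | zero  , I10 with mono Ii1 I10 (s≤s z≤n)
      ...   | ()
      c′ : Corr R (single A p) (tail β e)
      c′ = I′
         , (λ I′ij → proj₁ (I⊆Ind I′ij) , s≤s⁻¹ (subst (_ ∈Ind_) e (proj₂ (I⊆Ind I′ij))))
         , I⊆R , (λ I′ij I′i′j′ i<i′ → s≤s⁻¹ (mono I′ij I′i′j′ i<i′))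
         , I′-total , (λ j j≤k → total⁻¹ (suc j) (subst (_ ∈Ind_) (sym e) (s≤s j≤k)))
         , I-step , I-stutˡ , I-stutʳ

  module _ (A B : Automaton) (f : State A → State B → Set) where
    open Fragments {A} {B} {f}


    normed⇒branching : (S : Set) (_<ₛ_ : S → S → Set) (n : Norm A B S) →
                       IsNormedForwardSim A B f S _<ₛ_ n → IsBranchingForwardSim A B f
    normed⇒branching S _<ₛ_ n (wf , start , sim) = start , λ p u fsu → matching p u fsu (wf (n p u))
      where
      matching : ∀ {s a t} (p : Step A s a t) u → f s u → Acc _<ₛ_ (n p u) →
                 Σ (Frag B) λ β → (st β 0 ≡ u) × Corr f (single A p) β
      matching p u fsu (acc smaller) with sim p u fsu
      ... | inj₁ (ftu , refl)              = idle u , refl , Corr-idle p u fsu ftu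
      ... | inj₂ (inj₁ (v , ftv , u→v))    = single B u→v , refl , Corr-single p u→v fsu ftv
      ... | inj₂ (inj₂ (v , fsv , u→v , n<)) with matching p v fsv (smaller n<)
      ...   | β , refl , c = prepend-τ u β u→v , refl , Corr-prepend-τ (single A p) u β u→v fsu c

    branching⇒normed : (n : Norm A B ℕ) → IsBranchingForwardSim A B f →
                       IsBranchingNorm A B f n → IsNormedForwardSim A B f ℕ _<_ n
    branching⇒normed n (start , _) shortest = <-wellFounded , start , sim
      where
      sim : ∀ {s a t} (p : Step A s a t) u → f s u →
            (f t u × a ≡ τ) ⊎ (∃ λ v → f t v × Step B u a v)
            ⊎ (∃ λ v → f s v × Step B u τ v × (n p v < n p u))
      sim p u fsu with proj₁ (proj₂ (shortest p u) fsu)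
      ... | β , len≡n , refl , c with firstMove p β len≡n c
      ...   | stutter ftu a≡τ  = inj₁ (ftu , a≡τ)
      ...   | match ftv u→v   = inj₂ (inj₁ (st β 1 , ftv , u→v))
      ...   | τ-lead e fsv u→v c′ = inj₂ (inj₂ (st β 1 , fsv , u→v ,
                subst (n p (st β 1) <_) (fin-injective (trans (sym e) len≡n))
                      (s≤s (proj₂ (proj₂ (shortest p (st β 1)) fsv) (tail β e) _ refl refl c′))))

theorem4p4 : (Act : Set) (τ : Act) → let open Automata Act τ in
    (A B : Automaton) (f : State A → State B → Set) →
    ((S : Set) (_<ₛ_ : S → S → Set) (n : Norm A B S) →
       IsNormedForwardSim A B f S _<ₛ_ n → IsBranchingForwardSim A B f)
    × ((n : Norm A B ℕ) → IsBranchingForwardSim A B f →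
       IsBranchingNorm A B f n → IsNormedForwardSim A B f ℕ _<_ n)
theorem4p4 Act τ A B f = normed⇒branching A B f , branching⇒normed A B f
  where open Simulations Act τ
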